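{- For every positive integer $n$, $$\sum_{j=1}^{2n+1} \binom{4n+2}{2j-1}\,(2n+1-j)\,\bigl(1-2^{2j-1}\bigr)\,B_{2j} \;=\; (4n+3)\,2^{4n}\,B_{4n+2}.$$
   Context: $(B_m)_{m\ge 0}$ denotes the Bernoulli numbers, defined by $\frac{x}{e^x-1}=\sum_{m\ge 0}B_m\frac{x^m}{m!}$ for $|x|<2\pi$ (so $B_0=1$, $B_1=-\tfrac12$, $B_2=\tfrac16$, $B_4=-\tfrac1{30}$, $B_6=\tfrac1{42}$, \ldots). -}

module Defs where

open import Data.Nat as ℕ using (ℕ; zero; suc)
open import Data.Nat.Combinatorics using (_C_)
open import Data.Integer as ℤ using (ℤ; +_)
open import Data.Rational using (ℚ; 0ℚ; 1ℚ; _+_; _*_; -_; _/_)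
open import Data.List using (List; []; _∷_; length; _++_; reverse; zip; upTo; map; foldr; lookup)
open import Data.Fin using (fromℕ<)

ℕ→ℚ : ℕ → ℚ
ℕ→ℚ n = + n / 1

sumℚ : List ℚ → ℚ
sumℚ = foldr _+_ 0ℚ

-- Bernoulli numbers with the convention B₁ = -1/2 (generating function x/(eˣ-1)),
-- computed by the standard recurrence equivalent to that generating function:
--   B₀ = 1,  B_m = -(1/(m+1)) Σ_{k=0}^{m-1} C(m+1,k) B_k   (m ≥ 1).
-- bernTable m = [B_m, B_{m-1}, …, B_0]  (reverse order).
bernTable : ℕ → List ℚ
bernTable zero = 1ℚ ∷ []
bernTable (suc m) = next ∷ prev
  where
  prev : List ℚ
  prev = bernTable m
  ks : List ℕ
  ks = upTo (suc m)
  terms : List ℚ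
  terms = map (λ p → ℕ→ℚ ((suc (suc m)) C (Data.Product.proj₁ p)) * Data.Product.proj₂ p)
              (zip ks (reverse prev))
    where import Data.Product
  next : ℚ
  next = - ((+ 1 / suc (suc m)) * sumℚ terms)

B : ℕ → ℚ
B zero = 1ℚ
B (suc m) with bernTable (suc m)
... | b ∷ _ = b
... | [] = 0ℚ

-- Σ_{j=a}^{b} f j  (sum over j = a, a+1, …, b; empty if b < a).
Σ[_⋯_] : ℕ → ℕ → (ℕ → ℚ) → ℚ
Σ[ a ⋯ b ] f = sumℚ (map (λ i → f (a ℕ.+ i)) (upTo (suc b ℕ.∸ a)))

{-# OPTIONS --safe #-}
-- Work with exponential generating series over ℚ, where β(x) = x/(eˣ-1) = Σ Bₘ xᵐ/m!.
-- Then α(x) = 2β(x) - β(2x) = x/sinh x is even with coefficients αₘ = 2(1 - 2ᵐ⁻¹)Bₘ, and by the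
-- binomial formula for products of such series the coefficient of x⁴ⁿ⁺²/(4n+2)! in
-- K(x) = α'(x)(x-1)eˣ - (x β(2x))' is 4·(LHS - RHS). That coefficient vanishes for n ≥ 1 because
-- K(x) + K(-x) = -2(1 + x²): multiplied by (2 sinh x)², this becomes a ring identity in x, e^{±x},
-- α, α', β(2x), β(2x)' modulo α · 2 sinh x = 2x, β(2x) · 2 sinh x = 2x e⁻ˣ and their derivatives.
module Submission where

open import Level using (0ℓ)
open import Function.Base using (_∘_)
open import Data.Product.Base using (_×_; _,_)
open import Data.Maybe.Base as Maybe using ()
open import Data.List.Base using (_∷_; map; upTo; applyUpTo; applyDownFrom; reverse; zip)
import Data.List.Properties as List
open import Data.Nat.Base as ℕ using (ℕ; zero; suc; _∸_; _^_; _≤_; _≥_; _<_; s≤s; z≤n)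
import Data.Nat.Properties as ℕP
open import Data.Nat.Combinatorics using (_C_; nCn≡1; nC1≡n; nCk≡nC[n∸k]; nCk+nC[k+1]≡[n+1]C[k+1])
open import Data.Nat.Combinatorics.Specification using (k>n⇒nCk≡0)
import Data.Nat.Coprimality as Coprime
open import Data.Nat.Tactic.RingSolver using () renaming (solve-∀ to ℕ-solve-∀)
import Data.Integer.Base as ℤ
import Data.Integer.Properties as ℤP
open import Data.Rational.Base using (ℚ; mkℚ; 0ℚ; 1ℚ; ½; _+_; _*_; -_; _-_; _/_; +-*-rawSemiring; +-*-rawRing)
import Data.Rational.Properties as ℚP
open import Algebra.Bundles using (CommutativeRing; CommutativeMonoid)
open import Algebra.Structures using (IsCommutativeRing)
open import Algebra.Definitions.RawSemiring +-*-rawSemiring using () renaming (_^_ to _^ℚ_)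
open import Algebra.Properties.Semiring.Exp (CommutativeRing.semiring ℚP.+-*-commutativeRing) using (^-assocʳ; ^-homo-*)
open import Algebra.Properties.CommutativeSemiring.Exp (CommutativeRing.commutativeSemiring ℚP.+-*-commutativeRing) using (^-distrib-*)
open import Algebra.Properties.CommutativeSemigroup (CommutativeMonoid.commutativeSemigroup ℚP.+-0-commutativeMonoid) using () renaming (interchange to +-interchange)
open import Algebra.Properties.Group ℚP.+-0-group using () renaming (x∙y⁻¹≈ε⇒x≈y to x-y≡0⇒x≡y)
import Algebra.Solver.Ring
import Algebra.Solver.Ring.AlmostCommutativeRing as ACR
import Tactic.RingSolver.Core.AlmostCommutativeRing as Reflective
open import Tactic.RingSolver using (solve-∀)
open import Relation.Nullary.Decidable.Core using (dec⇒maybe)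
open import Relation.Binary.PropositionalEquality using (_≡_; refl; sym; trans; cong; cong₂; module ≡-Reasoning)
import Relation.Binary.Reasoning.Setoid
open import Defs

-- Rational arithmetic

ℚ-ring : Reflective.AlmostCommutativeRing 0ℓ 0ℓ
ℚ-ring = Reflective.fromCommutativeRing ℚP.+-*-commutativeRing (λ p → dec⇒maybe (0ℚ ℚP.≟ p))

2ℚ 4ℚ : ℚ
2ℚ = ℕ→ℚ 2
4ℚ = 2ℚ * 2ℚ

ℕ→ℚ≡mkℚ : ∀ n → ℕ→ℚ n ≡ mkℚ (ℤ.+ n) 0 (Coprime.sym (Coprime.1-coprimeTo n))
ℕ→ℚ≡mkℚ n = ℚP.normalize-coprime (Coprime.sym (Coprime.1-coprimeTo n))

ℕ→ℚ-+ : ∀ m n → ℕ→ℚ (m ℕ.+ n) ≡ ℕ→ℚ m + ℕ→ℚ n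
ℕ→ℚ-+ m n = begin
  ℤ.+ (m ℕ.+ n) / 1                         ≡⟨ cong (_/ 1) (trans (ℤP.pos-+ m n) (sym (cong₂ ℤ._+_ (ℤP.*-identityʳ (ℤ.+ m)) (ℤP.*-identityʳ (ℤ.+ n))))) ⟩
  (ℤ.+ m ℤ.* ℤ.+ 1 ℤ.+ ℤ.+ n ℤ.* ℤ.+ 1) / 1  ≡⟨ cong₂ _+_ (ℕ→ℚ≡mkℚ m) (ℕ→ℚ≡mkℚ n) ⟨
  ℕ→ℚ m + ℕ→ℚ n                             ∎
  where open ≡-Reasoning

ℕ→ℚ-* : ∀ m n → ℕ→ℚ (m ℕ.* n) ≡ ℕ→ℚ m * ℕ→ℚ n
ℕ→ℚ-* m n = begin
  ℤ.+ (m ℕ.* n) / 1      ≡⟨ cong (_/ 1) (ℤP.pos-* m n) ⟩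
  (ℤ.+ m ℤ.* ℤ.+ n) / 1  ≡⟨ cong₂ _*_ (ℕ→ℚ≡mkℚ m) (ℕ→ℚ≡mkℚ n) ⟨
  ℕ→ℚ m * ℕ→ℚ n          ∎
  where open ≡-Reasoning

ℕ→ℚ-^ : ∀ m n → ℕ→ℚ (m ^ n) ≡ ℕ→ℚ m ^ℚ n
ℕ→ℚ-^ m zero    = refl
ℕ→ℚ-^ m (suc n) = trans (ℕ→ℚ-* m (m ^ n)) (cong (ℕ→ℚ m *_) (ℕ→ℚ-^ m n))

ℕ→ℚ-∸ : ∀ {m n} → n ℕ.≤ m → ℕ→ℚ (m ∸ n) ≡ ℕ→ℚ m - ℕ→ℚ n
ℕ→ℚ-∸ {m} {n} n≤m = begin
  ℕ→ℚ (m ∸ n)                         ≡⟨ cancel (ℕ→ℚ (m ∸ n)) (ℕ→ℚ n) ⟨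
  ℕ→ℚ (m ∸ n) + ℕ→ℚ n - ℕ→ℚ n         ≡⟨ cong (_- ℕ→ℚ n) (trans (sym (ℕ→ℚ-+ (m ∸ n) n)) (cong ℕ→ℚ (ℕP.m∸n+n≡m n≤m))) ⟩
  ℕ→ℚ m - ℕ→ℚ n                       ∎
  where
  open ≡-Reasoning
  cancel : ∀ p q → p + q - q ≡ p
  cancel = solve-∀ ℚ-ring

1/[1+n]*[1+n]≡1 : ∀ n → (ℤ.+ 1 / suc n) * ℕ→ℚ (suc n) ≡ 1ℚ
1/[1+n]*[1+n]≡1 n = trans (cong₂ _*_ (ℚP.normalize-coprime (Coprime.1-coprimeTo (suc n))) (ℕ→ℚ≡mkℚ (suc n)))
                          (ℚP.*-inverseˡ (mkℚ (ℤ.+ suc n) 0 (Coprime.sym (Coprime.1-coprimeTo (suc n)))))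

1^n≡1 : ∀ n → 1ℚ ^ℚ n ≡ 1ℚ
1^n≡1 zero    = refl
1^n≡1 (suc n) = trans (ℚP.*-identityˡ (1ℚ ^ℚ n)) (1^n≡1 n)

[-1]^[2n]≡1 : ∀ n → (- 1ℚ) ^ℚ (2 ℕ.* n) ≡ 1ℚ
[-1]^[2n]≡1 n = trans (sym (^-assocʳ (- 1ℚ) 2 n)) (1^n≡1 n)

invertible-*-cancelˡ : ∀ a b {p q} → b * a ≡ 1ℚ → a * p ≡ a * q → p ≡ q
invertible-*-cancelˡ a b {p} {q} ba≡1 ap≡aq = begin
  p             ≡⟨ ℚP.*-identityˡ p ⟨
  1ℚ * p        ≡⟨ cong (_* p) ba≡1 ⟨
  b * a * p     ≡⟨ ℚP.*-assoc b a p ⟩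
  b * (a * p)   ≡⟨ cong (b *_) ap≡aq ⟩
  b * (a * q)   ≡⟨ ℚP.*-assoc b a q ⟨
  b * a * q     ≡⟨ cong (_* q) ba≡1 ⟩
  1ℚ * q        ≡⟨ ℚP.*-identityˡ q ⟩
  q             ∎
  where open ≡-Reasoning

x+x≡0⇒x≡0 : ∀ x → x + x ≡ 0ℚ → x ≡ 0ℚ
x+x≡0⇒x≡0 x x+x≡0 = begin
  x             ≡⟨ halve x ⟩
  ½ * (x + x)   ≡⟨ cong (½ *_) x+x≡0 ⟩
  ½ * 0ℚ        ≡⟨ ℚP.*-zeroʳ ½ ⟩
  0ℚ            ∎
  where
  open ≡-Reasoning
  halve : ∀ x → x ≡ ½ * (x + x)
  halve = solve-∀ ℚ-ring

-x≡x⇒x≡0 : ∀ x → - x ≡ x → x ≡ 0ℚ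
-x≡x⇒x≡0 x -x≡x = x+x≡0⇒x≡0 x (trans (cong (x +_) (sym -x≡x)) (ℚP.+-inverseʳ x))

-- Finite sums

∑ : ℕ → (ℕ → ℚ) → ℚ
∑ zero    f = 0ℚ
∑ (suc n) f = f 0 + ∑ n (f ∘ suc)

syntax ∑ n (λ k → e) = ∑[ k < n ] e

sumℚ-applyUpTo : ∀ f n → sumℚ (applyUpTo f n) ≡ ∑ n f
sumℚ-applyUpTo f zero    = refl
sumℚ-applyUpTo f (suc n) = cong (f 0 +_) (sumℚ-applyUpTo (f ∘ suc) n)

∑-cong : ∀ n {f g} → (∀ k → k < n → f k ≡ g k) → ∑ n f ≡ ∑ n g
∑-cong zero    f≡g = refl
∑-cong (suc n) f≡g = cong₂ _+_ (f≡g 0 (s≤s z≤n)) (∑-cong n (λ k k<n → f≡g (suc k) (s≤s k<n)))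

∑-zero : ∀ n → ∑[ k < n ] 0ℚ ≡ 0ℚ
∑-zero zero    = refl
∑-zero (suc n) = trans (ℚP.+-identityˡ _) (∑-zero n)

∑-distrib-+ : ∀ n f g → ∑[ k < n ] (f k + g k) ≡ ∑ n f + ∑ n g
∑-distrib-+ zero    f g = refl
∑-distrib-+ (suc n) f g = trans (cong (f 0 + g 0 +_) (∑-distrib-+ n (f ∘ suc) (g ∘ suc)))
                                (+-interchange (f 0) (g 0) _ _)

*-distribˡ-∑ : ∀ q n f → q * ∑ n f ≡ ∑[ k < n ] (q * f k)
*-distribˡ-∑ q zero    f = ℚP.*-zeroʳ q
*-distribˡ-∑ q (suc n) f = trans (ℚP.*-distribˡ-+ q (f 0) _) (cong (q * f 0 +_) (*-distribˡ-∑ q n (f ∘ suc)))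

∑-init-last : ∀ n f → ∑ (suc n) f ≡ ∑ n f + f n
∑-init-last zero    f = trans (ℚP.+-identityʳ (f 0)) (sym (ℚP.+-identityˡ (f 0)))
∑-init-last (suc n) f = trans (cong (f 0 +_) (∑-init-last n (f ∘ suc))) (sym (ℚP.+-assoc (f 0) _ _))

∑-even-odd : ∀ m f → ∑ (2 ℕ.* m) f ≡ ∑[ j < m ] f (2 ℕ.* j) + ∑[ j < m ] f (suc (2 ℕ.* j))
∑-even-odd zero    f = refl
∑-even-odd (suc m) f = begin
  ∑ (2 ℕ.* suc m) f                                       ≡⟨ cong (λ t → ∑ t f) (ℕP.*-suc 2 m) ⟩
  f 0 + (f 1 + ∑ (2 ℕ.* m) (f ∘ suc ∘ suc))              ≡⟨ cong (λ t → f 0 + (f 1 + t)) (∑-even-odd m (f ∘ suc ∘ suc)) ⟩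
  f 0 + (f 1 + (even + odd))                              ≡⟨ regroup (f 0) (f 1) even odd ⟩
  (f 0 + even) + (f 1 + odd)                              ≡⟨ cong₂ (λ a b → (f 0 + a) + (f 1 + b)) (∑-cong m (λ j _ → cong f (ℕP.*-suc 2 j)))
                                                                                                (∑-cong m (λ j _ → cong (f ∘ suc) (ℕP.*-suc 2 j))) ⟨
  ∑[ j < suc m ] f (2 ℕ.* j) + ∑[ j < suc m ] f (suc (2 ℕ.* j)) ∎
  where
  open ≡-Reasoning
  even = ∑[ j < m ] f (suc (suc (2 ℕ.* j)))
  odd  = ∑[ j < m ] f (suc (suc (suc (2 ℕ.* j))))
  regroup : ∀ a b c d → a + (b + (c + d)) ≡ (a + c) + (b + d)
  regroup = solve-∀ ℚ-ring

-- Exponential generating series over ℚ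

-- A series a stands for Σ a k xᵏ/k!, so D is differentiation and _*ₛ_ is the binomial convolution,
-- defined through the Leibniz rule D (a *ₛ b) = D a *ₛ b +ₛ a *ₛ D b, which holds by definition.
Series : Set
Series = ℕ → ℚ

infix  4 _≈_
infixl 6 _+ₛ_ _-ₛ_
infixl 7 _*ₛ_ _·_
infix  8 -ₛ_

-- a record rather than ∀ k → a k ≡ b k, so that a and b can be inferred from a proof
record _≈_ (a b : Series) : Set where
  constructor pointwise
  field at : ∀ k → a k ≡ b k
open _≈_ public

≈-refl : ∀ {a} → a ≈ a
≈-refl = pointwise (λ _ → refl)

≈-sym : ∀ {a b} → a ≈ b → b ≈ a
≈-sym a≈b = pointwise (λ k → sym (at a≈b k))

≈-trans : ∀ {a b c} → a ≈ b → b ≈ c → a ≈ c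
≈-trans a≈b b≈c = pointwise (λ k → trans (at a≈b k) (at b≈c k))

_+ₛ_ : Series → Series → Series
(a +ₛ b) k = a k + b k

-ₛ_ : Series → Series
(-ₛ a) k = - a k

_-ₛ_ : Series → Series → Series
a -ₛ b = a +ₛ -ₛ b

_·_ : ℚ → Series → Series
(q · a) k = q * a k

+ₛ-cong : ∀ {a a' b b'} → a ≈ a' → b ≈ b' → a +ₛ b ≈ a' +ₛ b'
+ₛ-cong a≈a' b≈b' = pointwise λ k → cong₂ _+_ (at a≈a' k) (at b≈b' k)

+ₛ-congˡ : ∀ a {b b'} → b ≈ b' → a +ₛ b ≈ a +ₛ b'
+ₛ-congˡ a = +ₛ-cong (≈-refl {a})

+ₛ-congʳ : ∀ b {a a'} → a ≈ a' → a +ₛ b ≈ a' +ₛ b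
+ₛ-congʳ b a≈a' = +ₛ-cong a≈a' (≈-refl {b})

-ₛ-cong : ∀ {a a'} → a ≈ a' → -ₛ a ≈ -ₛ a'
-ₛ-cong a≈a' = pointwise λ k → cong -_ (at a≈a' k)

const : ℚ → Series
const q zero    = q
const q (suc _) = 0ℚ

0ₛ 1ₛ X : Series
0ₛ _ = 0ℚ
1ₛ = const 1ℚ
X zero    = 0ℚ
X (suc k) = 1ₛ k

D : Series → Series
D a k = a (suc k)

_*ₛ_ : Series → Series → Series
(a *ₛ b) zero    = a 0 * b 0
(a *ₛ b) (suc n) = (D a *ₛ b) n + (a *ₛ D b) n

*ₛ-cong : ∀ {a a' b b'} → a ≈ a' → b ≈ b' → a *ₛ b ≈ a' *ₛ b'
*ₛ-cong a≈a' b≈b' = pointwise (go (at a≈a') (at b≈b'))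
  where
  go : ∀ {a a' b b'} → (∀ k → a k ≡ a' k) → (∀ k → b k ≡ b' k) → ∀ n → (a *ₛ b) n ≡ (a' *ₛ b') n
  go a≡a' b≡b' zero    = cong₂ _*_ (a≡a' 0) (b≡b' 0)
  go a≡a' b≡b' (suc n) = cong₂ _+_ (go (a≡a' ∘ suc) b≡b' n) (go a≡a' (b≡b' ∘ suc) n)

*ₛ-congˡ : ∀ a {b b'} → b ≈ b' → a *ₛ b ≈ a *ₛ b'
*ₛ-congˡ a = *ₛ-cong (≈-refl {a})

*ₛ-congʳ : ∀ b {a a'} → a ≈ a' → a *ₛ b ≈ a' *ₛ b
*ₛ-congʳ b a≈a' = *ₛ-cong a≈a' (≈-refl {b})

*ₛ-comm : ∀ a b → a *ₛ b ≈ b *ₛ a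
*ₛ-comm a b = pointwise (go a b)
  where
  go : ∀ a b n → (a *ₛ b) n ≡ (b *ₛ a) n
  go a b zero    = ℚP.*-comm (a 0) (b 0)
  go a b (suc n) = trans (cong₂ _+_ (go (D a) b n) (go a (D b) n)) (ℚP.+-comm ((b *ₛ D a) n) ((D b *ₛ a) n))

*ₛ-distribʳ : ∀ c a b → (a +ₛ b) *ₛ c ≈ a *ₛ c +ₛ b *ₛ c
*ₛ-distribʳ c a b = pointwise (go c a b)
  where
  go : ∀ c a b n → ((a +ₛ b) *ₛ c) n ≡ (a *ₛ c) n + (b *ₛ c) n
  go c a b zero    = ℚP.*-distribʳ-+ (c 0) (a 0) (b 0)
  go c a b (suc n) = trans (cong₂ _+_ (go c (D a) (D b) n) (go (D c) a b n))
                           (+-interchange ((D a *ₛ c) n) ((D b *ₛ c) n) ((a *ₛ D c) n) ((b *ₛ D c) n))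

*ₛ-distribˡ : ∀ a b c → a *ₛ (b +ₛ c) ≈ a *ₛ b +ₛ a *ₛ c
*ₛ-distribˡ a b c = pointwise λ k → trans (at (*ₛ-comm a (b +ₛ c)) k)
  (trans (at (*ₛ-distribʳ a b c) k) (cong₂ _+_ (at (*ₛ-comm b a) k) (at (*ₛ-comm c a) k)))

*ₛ-assoc : ∀ a b c → (a *ₛ b) *ₛ c ≈ a *ₛ (b *ₛ c)
*ₛ-assoc a b c = pointwise (go a b c)
  where
  go : ∀ a b c n → ((a *ₛ b) *ₛ c) n ≡ (a *ₛ (b *ₛ c)) n
  go a b c zero    = ℚP.*-assoc (a 0) (b 0) (c 0)
  go a b c (suc n) = begin
    ((D a *ₛ b +ₛ a *ₛ D b) *ₛ c) n + ((a *ₛ b) *ₛ D c) n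
      ≡⟨ cong (_+ ((a *ₛ b) *ₛ D c) n) (at (*ₛ-distribʳ c (D a *ₛ b) (a *ₛ D b)) n) ⟩
    ((D a *ₛ b) *ₛ c) n + ((a *ₛ D b) *ₛ c) n + ((a *ₛ b) *ₛ D c) n
      ≡⟨ cong₂ _+_ (cong₂ _+_ (go (D a) b c n) (go a (D b) c n)) (go a b (D c) n) ⟩
    (D a *ₛ (b *ₛ c)) n + (a *ₛ (D b *ₛ c)) n + (a *ₛ (b *ₛ D c)) n
      ≡⟨ ℚP.+-assoc ((D a *ₛ (b *ₛ c)) n) ((a *ₛ (D b *ₛ c)) n) ((a *ₛ (b *ₛ D c)) n) ⟩
    (D a *ₛ (b *ₛ c)) n + ((a *ₛ (D b *ₛ c)) n + (a *ₛ (b *ₛ D c)) n)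
      ≡⟨ cong ((D a *ₛ (b *ₛ c)) n +_) (at (*ₛ-distribˡ a (D b *ₛ c) (b *ₛ D c)) n) ⟨
    (D a *ₛ (b *ₛ c)) n + (a *ₛ (D b *ₛ c +ₛ b *ₛ D c)) n
      ∎
    where open ≡-Reasoning

·-*ₛ : ∀ q a b → (q · a) *ₛ b ≈ q · (a *ₛ b)
·-*ₛ q a b = pointwise (go a b)
  where
  go : ∀ a b n → ((q · a) *ₛ b) n ≡ q * (a *ₛ b) n
  go a b zero    = ℚP.*-assoc q (a 0) (b 0)
  go a b (suc n) = trans (cong₂ _+_ (go (D a) b n) (go a (D b) n)) (sym (ℚP.*-distribˡ-+ q ((D a *ₛ b) n) ((a *ₛ D b) n)))

*ₛ-zeroˡ : ∀ a → 0ₛ *ₛ a ≈ 0ₛ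
*ₛ-zeroˡ a = pointwise (go a)
  where
  go : ∀ a n → (0ₛ *ₛ a) n ≡ 0ℚ
  go a zero    = ℚP.*-zeroˡ (a 0)
  go a (suc n) = trans (cong₂ _+_ (go a n) (go (D a) n)) (ℚP.+-identityˡ 0ℚ)

const-*ₛ : ∀ q a → const q *ₛ a ≈ q · a
const-*ₛ q a = pointwise (go a)
  where
  go : ∀ a n → (const q *ₛ a) n ≡ q * a n
  go a zero    = refl
  go a (suc n) = trans (cong₂ _+_ (at (*ₛ-zeroˡ a) n) (go (D a) n)) (ℚP.+-identityˡ (q * a (suc n)))

series-isCommutativeRing : IsCommutativeRing _≈_ _+ₛ_ _*ₛ_ -ₛ_ 0ₛ 1ₛ
series-isCommutativeRing = record
  { isRing = record
    { +-isAbelianGroup = record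
      { isGroup = record
        { isMonoid = record
          { isSemigroup = record
            { isMagma = record
              { isEquivalence = record { refl = ≈-refl ; sym = ≈-sym ; trans = ≈-trans }
              ; ∙-cong = +ₛ-cong }
            ; assoc = λ a b c → pointwise λ k → ℚP.+-assoc (a k) (b k) (c k) }
          ; identity = (λ a → pointwise λ k → ℚP.+-identityˡ (a k)) , (λ a → pointwise λ k → ℚP.+-identityʳ (a k)) }
        ; inverse = (λ a → pointwise λ k → ℚP.+-inverseˡ (a k)) , (λ a → pointwise λ k → ℚP.+-inverseʳ (a k))
        ; ⁻¹-cong = -ₛ-cong }
      ; comm = λ a b → pointwise λ k → ℚP.+-comm (a k) (b k) }
    ; *-cong = *ₛ-cong
    ; *-assoc = *ₛ-assoc
    ; *-identity = *ₛ-identityˡ , λ a → ≈-trans (*ₛ-comm a 1ₛ) (*ₛ-identityˡ a)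
    ; distrib = *ₛ-distribˡ , *ₛ-distribʳ }
  ; *-comm = *ₛ-comm }
  where
  *ₛ-identityˡ : ∀ a → 1ₛ *ₛ a ≈ a
  *ₛ-identityˡ a = ≈-trans (const-*ₛ 1ℚ a) (pointwise λ k → ℚP.*-identityˡ (a k))

series-ring : CommutativeRing 0ℓ 0ℓ
series-ring = record { isCommutativeRing = series-isCommutativeRing }

const-homomorphism : +-*-rawRing ACR.-Raw-AlmostCommutative⟶ ACR.fromCommutativeRing series-ring
const-homomorphism = record
  { ⟦_⟧    = const
  ; +-homo = λ p q → pointwise λ { zero → refl ; (suc _) → refl }
  ; *-homo = λ p q → ≈-sym (≈-trans (const-*ₛ p (const q)) (pointwise λ { zero → refl ; (suc _) → ℚP.*-zeroʳ p }))
  ; -‿homo = λ p → pointwise λ { zero → refl ; (suc _) → refl }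
  ; 0-homo = pointwise λ { zero → refl ; (suc _) → refl }
  ; 1-homo = ≈-refl }

open Algebra.Solver.Ring +-*-rawRing (ACR.fromCommutativeRing series-ring) const-homomorphism
       (λ p q → Maybe.map (λ p≡q → pointwise λ k → cong (λ r → const r k) p≡q) (dec⇒maybe (p ℚP.≟ q)))
  using (solve; _:+_; _:-_; _:*_; :-_; _:=_; con)

module ≈-Reasoning = Relation.Binary.Reasoning.Setoid (CommutativeRing.setoid series-ring)

linear-combination : ∀ {t t' l r} p → l ≈ r → t ≈ t' +ₛ p *ₛ (l -ₛ r) → t ≈ t'
linear-combination {t} {t'} {l} {r} p l≈r t≈ = begin
  t                         ≈⟨ t≈ ⟩
  t' +ₛ p *ₛ (l -ₛ r)       ≈⟨ +ₛ-congˡ t' (*ₛ-congˡ p (+ₛ-congʳ (-ₛ r) l≈r)) ⟩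
  t' +ₛ p *ₛ (r -ₛ r)       ≈⟨ solve 3 (λ t' p r → t' :+ p :* (r :- r) := t') ≈-refl t' p r ⟩
  t'                        ∎
  where open ≈-Reasoning

X*ₛ-suc : ∀ a n → (X *ₛ a) (suc n) ≡ ℕ→ℚ (suc n) * a n
X*ₛ-suc a zero    = trans (cong₂ _+_ (at (const-*ₛ 1ℚ a) 0) (ℚP.*-zeroˡ (a 1))) (ℚP.+-identityʳ (1ℚ * a 0))
X*ₛ-suc a (suc n) = begin
  (1ₛ *ₛ a) (suc n) + (X *ₛ D a) (suc n)      ≡⟨ cong₂ _+_ (at (const-*ₛ 1ℚ a) (suc n)) (X*ₛ-suc (D a) n) ⟩
  1ℚ * a (suc n) + ℕ→ℚ (suc n) * a (suc n)    ≡⟨ ℚP.*-distribʳ-+ (a (suc n)) 1ℚ (ℕ→ℚ (suc n)) ⟨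
  (1ℚ + ℕ→ℚ (suc n)) * a (suc n)              ≡⟨ cong (_* a (suc n)) (ℕ→ℚ-+ 1 (suc n)) ⟨
  ℕ→ℚ (suc (suc n)) * a (suc n)               ∎
  where open ≡-Reasoning

X*ₛ-cancelˡ : ∀ {a b} → X *ₛ a ≈ X *ₛ b → a ≈ b
X*ₛ-cancelˡ {a} {b} Xa≈Xb = pointwise λ k → invertible-*-cancelˡ (ℕ→ℚ (suc k)) (ℤ.+ 1 / suc k) (1/[1+n]*[1+n]≡1 k)
  (trans (sym (X*ₛ-suc a k)) (trans (at Xa≈Xb (suc k)) (X*ₛ-suc b k)))

*ₛ-cancelʳ-divisor-of-X : ∀ {u v a b} → v *ₛ u ≈ X → a *ₛ u ≈ b *ₛ u → a ≈ b
*ₛ-cancelʳ-divisor-of-X {u} {v} {a} {b} vu≈X au≈bu = X*ₛ-cancelˡ (begin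
  X *ₛ a          ≈⟨ *ₛ-congʳ a vu≈X ⟨
  v *ₛ u *ₛ a     ≈⟨ solve 3 (λ v u a → v :* u :* a := v :* (a :* u)) ≈-refl v u a ⟩
  v *ₛ (a *ₛ u)   ≈⟨ *ₛ-congˡ v au≈bu ⟩
  v *ₛ (b *ₛ u)   ≈⟨ solve 3 (λ v u b → v :* (b :* u) := v :* u :* b) ≈-refl v u b ⟩
  v *ₛ u *ₛ b     ≈⟨ *ₛ-congʳ b vu≈X ⟩
  X *ₛ b          ∎)
  where open ≈-Reasoning

*ₛ-cancelʳ-unit : ∀ {u v a b} → u *ₛ v ≈ 1ₛ → a *ₛ u ≈ b *ₛ u → a ≈ b
*ₛ-cancelʳ-unit {u} {v} {a} {b} uv≈1 au≈bu = begin
  a               ≈⟨ solve 1 (λ a → a := a :* con 1ℚ) ≈-refl a ⟩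
  a *ₛ 1ₛ         ≈⟨ *ₛ-congˡ a uv≈1 ⟨
  a *ₛ (u *ₛ v)   ≈⟨ solve 3 (λ a u v → a :* (u :* v) := a :* u :* v) ≈-refl a u v ⟩
  a *ₛ u *ₛ v     ≈⟨ *ₛ-congʳ v au≈bu ⟩
  b *ₛ u *ₛ v     ≈⟨ solve 3 (λ b u v → b :* u :* v := b :* (u :* v)) ≈-refl b u v ⟩
  b *ₛ (u *ₛ v)   ≈⟨ *ₛ-congˡ b uv≈1 ⟩
  b *ₛ 1ₛ         ≈⟨ solve 1 (λ b → b :* con 1ℚ := b) ≈-refl b ⟩
  b               ∎
  where open ≈-Reasoning

-- scale c a = a(cx) and exp c = e^{cx}
scale : ℚ → Series → Series
scale c a k = c ^ℚ k * a k

exp : ℚ → Series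
exp c k = c ^ℚ k

scale-cong : ∀ c {a b} → a ≈ b → scale c a ≈ scale c b
scale-cong c a≈b = pointwise λ k → cong (c ^ℚ k *_) (at a≈b k)

scale-+ₛ : ∀ c a b → scale c (a +ₛ b) ≈ scale c a +ₛ scale c b
scale-+ₛ c a b = pointwise λ k → ℚP.*-distribˡ-+ (c ^ℚ k) (a k) (b k)

scale-neg : ∀ c a → scale c (-ₛ a) ≈ -ₛ scale c a
scale-neg c a = pointwise λ k → sym (ℚP.neg-distribʳ-* (c ^ℚ k) (a k))

scale-const : ∀ c q → scale c (const q) ≈ const q
scale-const c q = pointwise λ { zero → ℚP.*-identityˡ q ; (suc k) → ℚP.*-zeroʳ (c ^ℚ suc k) }

scale-X : ∀ c → scale c X ≈ const c *ₛ X
scale-X c = ≈-trans (pointwise coeff) (≈-sym (const-*ₛ c X))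
  where
  coeff : ∀ k → c ^ℚ k * X k ≡ c * X k
  coeff zero          = trans (ℚP.*-zeroʳ 1ℚ) (sym (ℚP.*-zeroʳ c))
  coeff (suc zero)    = ℚP.*-identityʳ (c * 1ℚ)
  coeff (suc (suc k)) = trans (ℚP.*-zeroʳ (c ^ℚ suc (suc k))) (sym (ℚP.*-zeroʳ c))

scale-scale : ∀ c d a → scale c (scale d a) ≈ scale d (scale c a)
scale-scale c d a = pointwise λ k → swap (c ^ℚ k) (d ^ℚ k) (a k)
  where
  swap : ∀ p q r → p * (q * r) ≡ q * (p * r)
  swap = solve-∀ ℚ-ring

scale-exp : ∀ c d → scale c (exp d) ≈ exp (c * d)
scale-exp c d = pointwise λ k → sym (^-distrib-* c d k)

D-scale : ∀ c a → D (scale c a) ≈ c · scale c (D a)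
D-scale c a = pointwise λ k → ℚP.*-assoc c (c ^ℚ k) (a (suc k))

*ₛ-· : ∀ q a b → a *ₛ (q · b) ≈ q · (a *ₛ b)
*ₛ-· q a b = ≈-trans (*ₛ-comm a (q · b)) (≈-trans (·-*ₛ q b a) (pointwise λ k → cong (q *_) (at (*ₛ-comm b a) k)))

scale-*ₛ : ∀ c a b → scale c (a *ₛ b) ≈ scale c a *ₛ scale c b
scale-*ₛ c a b = ≈-sym (pointwise (go a b))
  where
  go : ∀ a b n → (scale c a *ₛ scale c b) n ≡ c ^ℚ n * (a *ₛ b) n
  go a b zero    = unit (a 0) (b 0)
    where
    unit : ∀ x y → 1ℚ * x * (1ℚ * y) ≡ 1ℚ * (x * y)
    unit = solve-∀ ℚ-ring
  go a b (suc n) = begin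
    (D (scale c a) *ₛ scale c b) n + (scale c a *ₛ D (scale c b)) n
      ≡⟨ cong₂ _+_ (at (*ₛ-cong (D-scale c a) ≈-refl) n) (at (*ₛ-cong ≈-refl (D-scale c b)) n) ⟩
    ((c · scale c (D a)) *ₛ scale c b) n + (scale c a *ₛ (c · scale c (D b))) n
      ≡⟨ cong₂ _+_ (at (·-*ₛ c (scale c (D a)) (scale c b)) n) (at (*ₛ-· c (scale c a) (scale c (D b))) n) ⟩
    c * (scale c (D a) *ₛ scale c b) n + c * (scale c a *ₛ scale c (D b)) n
      ≡⟨ cong₂ (λ x y → c * x + c * y) (go (D a) b n) (go a (D b) n) ⟩
    c * (c ^ℚ n * (D a *ₛ b) n) + c * (c ^ℚ n * (a *ₛ D b) n)
      ≡⟨ factor c (c ^ℚ n) ((D a *ₛ b) n) ((a *ₛ D b) n) ⟩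
    c * c ^ℚ n * ((D a *ₛ b) n + (a *ₛ D b) n) ∎
    where
    open ≡-Reasoning
    factor : ∀ c p x y → c * (p * x) + c * (p * y) ≡ c * p * (x + y)
    factor = solve-∀ ℚ-ring

exp-+ : ∀ c d → exp c *ₛ exp d ≈ exp (c + d)
exp-+ c d = pointwise go
  where
  go : ∀ n → (exp c *ₛ exp d) n ≡ (c + d) ^ℚ n
  go zero    = refl
  go (suc n) = begin
    ((c · exp c) *ₛ exp d) n + (exp c *ₛ (d · exp d)) n  ≡⟨ cong₂ _+_ (at (·-*ₛ c (exp c) (exp d)) n) (at (*ₛ-· d (exp c) (exp d)) n) ⟩
    c * (exp c *ₛ exp d) n + d * (exp c *ₛ exp d) n      ≡⟨ ℚP.*-distribʳ-+ ((exp c *ₛ exp d) n) c d ⟨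
    (c + d) * (exp c *ₛ exp d) n                         ≡⟨ cong ((c + d) *_) (go n) ⟩
    (c + d) * (c + d) ^ℚ n                               ∎
    where open ≡-Reasoning

exp-0 : exp 0ℚ ≈ 1ₛ
exp-0 = pointwise λ { zero → refl ; (suc k) → ℚP.*-zeroˡ (0ℚ ^ℚ k) }

eˣ e⁻ˣ : Series
eˣ  = exp 1ℚ
e⁻ˣ = exp (- 1ℚ)

eˣ*ₛe⁻ˣ : eˣ *ₛ e⁻ˣ ≈ 1ₛ
eˣ*ₛe⁻ˣ = ≈-trans (exp-+ 1ℚ (- 1ℚ)) exp-0

D-cong : ∀ {a b} → a ≈ b → D a ≈ D b
D-cong a≈b = pointwise λ k → at a≈b (suc k)

D-exp : ∀ c → D (exp c) ≈ const c *ₛ exp c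
D-exp c = ≈-sym (const-*ₛ c (exp c))

D-const*ₛX : ∀ q → D (const q *ₛ X) ≈ const q
D-const*ₛX q = ≈-trans (D-cong (const-*ₛ q X)) (pointwise λ { zero → ℚP.*-identityʳ q ; (suc k) → ℚP.*-zeroʳ q })

reflect : Series → Series
reflect = scale (- 1ℚ)

reflect-D : ∀ a → reflect (D a) ≈ -ₛ D (reflect a)
reflect-D a = pointwise λ k → flip ((- 1ℚ) ^ℚ k) (a (suc k))
  where
  flip : ∀ p x → p * x ≡ - (- 1ℚ * p * x)
  flip = solve-∀ ℚ-ring

reflect-X : reflect X ≈ -ₛ X
reflect-X = ≈-trans (scale-X (- 1ℚ)) (solve 1 (λ x → con (- 1ℚ) :* x := :- x) ≈-refl X)

reflect-eˣ : reflect eˣ ≈ e⁻ˣ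
reflect-eˣ = scale-exp (- 1ℚ) 1ℚ

scale-exp-1 : ∀ c d → scale c (exp d -ₛ 1ₛ) ≈ exp (c * d) -ₛ 1ₛ
scale-exp-1 c d = ≈-trans (scale-+ₛ c (exp d) (-ₛ 1ₛ))
  (+ₛ-cong (scale-exp c d) (≈-trans (scale-neg c 1ₛ) (-ₛ-cong (scale-const c 1ℚ))))

reflect-even-coeff : ∀ a j → reflect a (2 ℕ.* j) ≡ a (2 ℕ.* j)
reflect-even-coeff a j = trans (cong (_* a (2 ℕ.* j)) ([-1]^[2n]≡1 j)) (ℚP.*-identityˡ (a (2 ℕ.* j)))

reflect-odd-coeff : ∀ a j → reflect a (suc (2 ℕ.* j)) ≡ - a (suc (2 ℕ.* j))
reflect-odd-coeff a j = begin
  - 1ℚ * (- 1ℚ) ^ℚ (2 ℕ.* j) * a k  ≡⟨ cong (λ p → - 1ℚ * p * a k) ([-1]^[2n]≡1 j) ⟩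
  - 1ℚ * 1ℚ * a k                   ≡⟨ negate (a k) ⟩
  - a k                             ∎
  where
  open ≡-Reasoning
  k = suc (2 ℕ.* j)
  negate : ∀ x → - 1ℚ * 1ℚ * x ≡ - x
  negate = solve-∀ ℚ-ring

even-series-odd-coeff : ∀ {a} → reflect a ≈ a → ∀ j → a (suc (2 ℕ.* j)) ≡ 0ℚ
even-series-odd-coeff {a} a-even j = -x≡x⇒x≡0 (a (suc (2 ℕ.* j))) (trans (sym (reflect-odd-coeff a j)) (at a-even (suc (2 ℕ.* j))))

1+X²-high-coeff : ∀ N → 3 ≤ N → (1ₛ +ₛ X *ₛ X) N ≡ 0ℚ
1+X²-high-coeff (suc (suc (suc m))) (s≤s (s≤s (s≤s z≤n))) =
  trans (ℚP.+-identityˡ ((X *ₛ X) (3 ℕ.+ m))) (trans (X*ₛ-suc X (2 ℕ.+ m)) (ℚP.*-zeroʳ (ℕ→ℚ (3 ℕ.+ m))))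

∑-pascal : ∀ n (f : ℕ → ℚ) → ∑[ k < suc (suc n) ] (ℕ→ℚ (suc n C k) * f k)
                 ≡ ∑[ k < suc n ] (ℕ→ℚ (n C k) * f (suc k)) + ∑[ k < suc n ] (ℕ→ℚ (n C k) * f k)
∑-pascal n f = begin
  1ℚ * f 0 + ∑[ k < suc n ] (ℕ→ℚ (suc n C suc k) * f (suc k))
    ≡⟨ cong (λ t → 1ℚ * f 0 + t) (∑-cong (suc n) (λ k _ → pascal k)) ⟩
  1ℚ * f 0 + ∑[ k < suc n ] (ℕ→ℚ (n C k) * f (suc k) + ℕ→ℚ (n C suc k) * f (suc k))
    ≡⟨ cong (λ t → 1ℚ * f 0 + t) (∑-distrib-+ (suc n) (λ k → ℕ→ℚ (n C k) * f (suc k)) (λ k → ℕ→ℚ (n C suc k) * f (suc k))) ⟩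
  1ℚ * f 0 + (shifted + ∑[ k < suc n ] (ℕ→ℚ (n C suc k) * f (suc k)))
    ≡⟨ cong (λ t → 1ℚ * f 0 + (shifted + t)) (∑-init-last n (λ k → ℕ→ℚ (n C suc k) * f (suc k))) ⟩
  1ℚ * f 0 + (shifted + (rest + ℕ→ℚ (n C suc n) * f (suc n)))
    ≡⟨ cong (λ m → 1ℚ * f 0 + (shifted + (rest + ℕ→ℚ m * f (suc n)))) (k>n⇒nCk≡0 (ℕP.n<1+n n)) ⟩
  1ℚ * f 0 + (shifted + (rest + 0ℚ * f (suc n)))
    ≡⟨ regroup (f 0) shifted rest (f (suc n)) ⟩
  shifted + (1ℚ * f 0 + rest) ∎
  where
  open ≡-Reasoning
  shifted = ∑[ k < suc n ] (ℕ→ℚ (n C k) * f (suc k))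
  rest    = ∑[ k < n ] (ℕ→ℚ (n C suc k) * f (suc k))
  pascal : ∀ k → ℕ→ℚ (suc n C suc k) * f (suc k) ≡ ℕ→ℚ (n C k) * f (suc k) + ℕ→ℚ (n C suc k) * f (suc k)
  pascal k = begin
    ℕ→ℚ (suc n C suc k) * f (suc k)                    ≡⟨ cong (λ m → ℕ→ℚ m * f (suc k)) (nCk+nC[k+1]≡[n+1]C[k+1] n k) ⟨
    ℕ→ℚ (n C k ℕ.+ n C suc k) * f (suc k)              ≡⟨ cong (_* f (suc k)) (ℕ→ℚ-+ (n C k) (n C suc k)) ⟩
    (ℕ→ℚ (n C k) + ℕ→ℚ (n C suc k)) * f (suc k)        ≡⟨ ℚP.*-distribʳ-+ (f (suc k)) (ℕ→ℚ (n C k)) (ℕ→ℚ (n C suc k)) ⟩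
    ℕ→ℚ (n C k) * f (suc k) + ℕ→ℚ (n C suc k) * f (suc k) ∎
  regroup : ∀ a s r z → 1ℚ * a + (s + (r + 0ℚ * z)) ≡ s + (1ℚ * a + r)
  regroup = solve-∀ ℚ-ring

*ₛ-binomial : ∀ a b n → (a *ₛ b) n ≡ ∑[ k < suc n ] (ℕ→ℚ (n C k) * (a k * b (n ∸ k)))
*ₛ-binomial a b zero    = unit (a 0 * b 0)
  where
  unit : ∀ x → x ≡ 1ℚ * x + 0ℚ
  unit = solve-∀ ℚ-ring
*ₛ-binomial a b (suc n) = begin
  (D a *ₛ b) n + (a *ₛ D b) n
    ≡⟨ cong₂ _+_ (*ₛ-binomial (D a) b n) (*ₛ-binomial a (D b) n) ⟩
  ∑[ k < suc n ] (ℕ→ℚ (n C k) * (a (suc k) * b (n ∸ k))) + ∑[ k < suc n ] (ℕ→ℚ (n C k) * (a k * b (suc (n ∸ k))))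
    ≡⟨ cong (∑ (suc n) (λ k → ℕ→ℚ (n C k) * (a (suc k) * b (n ∸ k))) +_)
            (∑-cong (suc n) λ k k<1+n → cong (λ m → ℕ→ℚ (n C k) * (a k * b m)) (sym (ℕP.+-∸-assoc 1 (ℕP.≤-pred k<1+n)))) ⟩
  ∑[ k < suc n ] (ℕ→ℚ (n C k) * (a (suc k) * b (n ∸ k))) + ∑[ k < suc n ] (ℕ→ℚ (n C k) * (a k * b (suc n ∸ k)))
    ≡⟨ ∑-pascal n (λ k → a k * b (suc n ∸ k)) ⟨
  ∑[ k < suc (suc n) ] (ℕ→ℚ (suc n C k) * (a k * b (suc n ∸ k))) ∎
  where open ≡-Reasoning

module BernoulliSeries (β : Series) (β-egf : β *ₛ (eˣ -ₛ 1ₛ) ≈ X) where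

  -- β = x/(eˣ-1), β₂ = β(2x), α = 2β(x) - β(2x) = x/sinh x and w = (x-1)eˣ
  β₂ α 2sinh 2cosh w : Series
  β₂    = scale 2ℚ β
  α     = const 2ℚ *ₛ β -ₛ β₂
  2sinh = eˣ -ₛ e⁻ˣ
  2cosh = eˣ +ₛ e⁻ˣ
  w     = X *ₛ eˣ -ₛ eˣ

  reflect-β : reflect β ≈ β +ₛ X
  reflect-β = begin
    reflect β                ≈⟨ solve 2 (λ r x → r := (r :- x) :+ x) ≈-refl (reflect β) X ⟩
    (reflect β -ₛ X) +ₛ X    ≈⟨ +ₛ-congʳ X (*ₛ-cancelʳ-divisor-of-X β-egf shifted) ⟩
    β +ₛ X                   ∎
    where
    open ≈-Reasoning
    reflected-egf : reflect β *ₛ (e⁻ˣ -ₛ 1ₛ) ≈ -ₛ X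
    reflected-egf = begin
      reflect β *ₛ (e⁻ˣ -ₛ 1ₛ)              ≈⟨ *ₛ-congˡ (reflect β) (scale-exp-1 (- 1ℚ) 1ℚ) ⟨
      reflect β *ₛ reflect (eˣ -ₛ 1ₛ)       ≈⟨ scale-*ₛ (- 1ℚ) β (eˣ -ₛ 1ₛ) ⟨
      reflect (β *ₛ (eˣ -ₛ 1ₛ))             ≈⟨ scale-cong (- 1ℚ) β-egf ⟩
      reflect X                             ≈⟨ reflect-X ⟩
      -ₛ X                                  ∎
    shifted : (reflect β -ₛ X) *ₛ (eˣ -ₛ 1ₛ) ≈ β *ₛ (eˣ -ₛ 1ₛ)
    shifted = ≈-trans
      (linear-combination (reflect β) eˣ*ₛe⁻ˣ (linear-combination (-ₛ eˣ) reflected-egf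
        (solve 4 (λ r x e ē → (r :- x) :* (e :- con 1ℚ)
                            := x :+ r :* (e :* ē :- con 1ℚ) :+ (:- e) :* (r :* (ē :- con 1ℚ) :- (:- x)))
                 ≈-refl (reflect β) X eˣ e⁻ˣ)))
      (≈-sym β-egf)

  β₂-egf : β₂ *ₛ (eˣ *ₛ eˣ -ₛ 1ₛ) ≈ const 2ℚ *ₛ X
  β₂-egf = begin
    β₂ *ₛ (eˣ *ₛ eˣ -ₛ 1ₛ)        ≈⟨ *ₛ-congˡ β₂ (+ₛ-congʳ (-ₛ 1ₛ) (exp-+ 1ℚ 1ℚ)) ⟩
    β₂ *ₛ (exp 2ℚ -ₛ 1ₛ)          ≈⟨ *ₛ-congˡ β₂ (scale-exp-1 2ℚ 1ℚ) ⟨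
    β₂ *ₛ scale 2ℚ (eˣ -ₛ 1ₛ)     ≈⟨ scale-*ₛ 2ℚ β (eˣ -ₛ 1ₛ) ⟨
    scale 2ℚ (β *ₛ (eˣ -ₛ 1ₛ))    ≈⟨ scale-cong 2ℚ β-egf ⟩
    scale 2ℚ X                    ≈⟨ scale-X 2ℚ ⟩
    const 2ℚ *ₛ X                 ∎
    where open ≈-Reasoning

  α*ₛ2sinh : α *ₛ 2sinh ≈ const 2ℚ *ₛ X
  α*ₛ2sinh = *ₛ-cancelʳ-unit eˣ*ₛe⁻ˣ
    (linear-combination (const 2ℚ *ₛ (eˣ +ₛ 1ₛ)) β-egf
    (linear-combination (-ₛ 1ₛ) β₂-egf
    (linear-combination (-ₛ α) eˣ*ₛe⁻ˣ
    (solve 5 (λ b b₂ x e ē →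
         (con 2ℚ :* b :- b₂) :* (e :- ē) :* e
      := con 2ℚ :* x :* e
         :+ con 2ℚ :* (e :+ con 1ℚ) :* (b :* (e :- con 1ℚ) :- x)
         :+ (:- con 1ℚ) :* (b₂ :* (e :* e :- con 1ℚ) :- con 2ℚ :* x)
         :+ (:- (con 2ℚ :* b :- b₂)) :* (e :* ē :- con 1ℚ))
       ≈-refl β β₂ X eˣ e⁻ˣ))))

  β₂*ₛ2sinh : β₂ *ₛ 2sinh ≈ const 2ℚ *ₛ X *ₛ e⁻ˣ
  β₂*ₛ2sinh = *ₛ-cancelʳ-unit eˣ*ₛe⁻ˣ
    (linear-combination 1ₛ β₂-egf
    (linear-combination (-ₛ (β₂ +ₛ const 2ℚ *ₛ X)) eˣ*ₛe⁻ˣ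
    (solve 4 (λ b₂ x e ē →
         b₂ :* (e :- ē) :* e
      := con 2ℚ :* x :* ē :* e
         :+ con 1ℚ :* (b₂ :* (e :* e :- con 1ℚ) :- con 2ℚ :* x)
         :+ (:- (b₂ :+ con 2ℚ :* x)) :* (e :* ē :- con 1ℚ))
       ≈-refl β₂ X eˣ e⁻ˣ)))

  reflect-β₂ : reflect β₂ ≈ β₂ +ₛ const 2ℚ *ₛ X
  reflect-β₂ = begin
    reflect (scale 2ℚ β)          ≈⟨ scale-scale (- 1ℚ) 2ℚ β ⟩
    scale 2ℚ (reflect β)          ≈⟨ scale-cong 2ℚ reflect-β ⟩
    scale 2ℚ (β +ₛ X)             ≈⟨ scale-+ₛ 2ℚ β X ⟩
    β₂ +ₛ scale 2ℚ X              ≈⟨ +ₛ-congˡ β₂ (scale-X 2ℚ) ⟩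
    β₂ +ₛ const 2ℚ *ₛ X           ∎
    where open ≈-Reasoning

  reflect-α : reflect α ≈ α
  reflect-α = begin
    reflect (const 2ℚ *ₛ β -ₛ β₂)                         ≈⟨ scale-+ₛ (- 1ℚ) (const 2ℚ *ₛ β) (-ₛ β₂) ⟩
    reflect (const 2ℚ *ₛ β) +ₛ reflect (-ₛ β₂)            ≈⟨ +ₛ-cong (scale-*ₛ (- 1ℚ) (const 2ℚ) β) (scale-neg (- 1ℚ) β₂) ⟩
    reflect (const 2ℚ) *ₛ reflect β -ₛ reflect β₂         ≈⟨ +ₛ-cong (*ₛ-cong (scale-const (- 1ℚ) 2ℚ) reflect-β) (-ₛ-cong reflect-β₂) ⟩
    const 2ℚ *ₛ (β +ₛ X) -ₛ (β₂ +ₛ const 2ℚ *ₛ X)         ≈⟨ solve 3 (λ b x b₂ → con 2ℚ :* (b :+ x) :- (b₂ :+ con 2ℚ :* x) := con 2ℚ :* b :- b₂)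
                                                                   ≈-refl β X β₂ ⟩
    α                                                     ∎
    where open ≈-Reasoning

  D-2sinh : D 2sinh ≈ 2cosh
  D-2sinh = begin
    D eˣ -ₛ D e⁻ˣ                              ≈⟨ +ₛ-cong (D-exp 1ℚ) (-ₛ-cong (D-exp (- 1ℚ))) ⟩
    const 1ℚ *ₛ eˣ -ₛ const (- 1ℚ) *ₛ e⁻ˣ       ≈⟨ solve 2 (λ e ē → con 1ℚ :* e :- con (- 1ℚ) :* ē := e :+ ē) ≈-refl eˣ e⁻ˣ ⟩
    2cosh                                      ∎
    where open ≈-Reasoning

  D[α*ₛ2sinh] : D α *ₛ 2sinh +ₛ α *ₛ 2cosh ≈ const 2ℚ
  D[α*ₛ2sinh] = begin
    D α *ₛ 2sinh +ₛ α *ₛ 2cosh      ≈⟨ +ₛ-congˡ (D α *ₛ 2sinh) (*ₛ-congˡ α D-2sinh) ⟨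
    D (α *ₛ 2sinh)                  ≈⟨ D-cong α*ₛ2sinh ⟩
    D (const 2ℚ *ₛ X)               ≈⟨ D-const*ₛX 2ℚ ⟩
    const 2ℚ                        ∎
    where open ≈-Reasoning

  D[β₂*ₛ2sinh] : D β₂ *ₛ 2sinh +ₛ β₂ *ₛ 2cosh ≈ const 2ℚ *ₛ e⁻ˣ -ₛ const 2ℚ *ₛ X *ₛ e⁻ˣ
  D[β₂*ₛ2sinh] = begin
    D β₂ *ₛ 2sinh +ₛ β₂ *ₛ 2cosh                                  ≈⟨ +ₛ-congˡ (D β₂ *ₛ 2sinh) (*ₛ-congˡ β₂ D-2sinh) ⟨
    D (β₂ *ₛ 2sinh)                                               ≈⟨ D-cong β₂*ₛ2sinh ⟩
    D (const 2ℚ *ₛ X) *ₛ e⁻ˣ +ₛ const 2ℚ *ₛ X *ₛ D e⁻ˣ            ≈⟨ +ₛ-cong (*ₛ-congʳ e⁻ˣ (D-const*ₛX 2ℚ)) (*ₛ-congˡ (const 2ℚ *ₛ X) (D-exp (- 1ℚ))) ⟩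
    const 2ℚ *ₛ e⁻ˣ +ₛ const 2ℚ *ₛ X *ₛ (const (- 1ℚ) *ₛ e⁻ˣ)     ≈⟨ solve 2 (λ x ē → con 2ℚ :* ē :+ con 2ℚ :* x :* (con (- 1ℚ) :* ē) := con 2ℚ :* ē :- con 2ℚ :* x :* ē)
                                                                       ≈-refl X e⁻ˣ ⟩
    const 2ℚ *ₛ e⁻ˣ -ₛ const 2ℚ *ₛ X *ₛ e⁻ˣ                       ∎
    where open ≈-Reasoning

  K : Series
  K = D α *ₛ w -ₛ D (X *ₛ β₂)

  reflect-w : reflect w ≈ (-ₛ X) *ₛ e⁻ˣ -ₛ e⁻ˣ
  reflect-w = begin
    reflect (X *ₛ eˣ -ₛ eˣ)                   ≈⟨ scale-+ₛ (- 1ℚ) (X *ₛ eˣ) (-ₛ eˣ) ⟩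
    reflect (X *ₛ eˣ) +ₛ reflect (-ₛ eˣ)      ≈⟨ +ₛ-cong (scale-*ₛ (- 1ℚ) X eˣ) (scale-neg (- 1ℚ) eˣ) ⟩
    reflect X *ₛ reflect eˣ -ₛ reflect eˣ     ≈⟨ +ₛ-cong (*ₛ-cong reflect-X reflect-eˣ) (-ₛ-cong reflect-eˣ) ⟩
    (-ₛ X) *ₛ e⁻ˣ -ₛ e⁻ˣ                      ∎
    where open ≈-Reasoning

  reflect-Dα : reflect (D α) ≈ -ₛ D α
  reflect-Dα = ≈-trans (reflect-D α) (-ₛ-cong (D-cong reflect-α))

  reflect-Dβ₂ : reflect (D β₂) ≈ -ₛ (D β₂ +ₛ const 2ℚ)
  reflect-Dβ₂ = ≈-trans (reflect-D β₂) (-ₛ-cong (≈-trans (D-cong reflect-β₂) (+ₛ-congˡ (D β₂) (D-const*ₛX 2ℚ))))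

  reflect-D[X*ₛβ₂] : reflect (D (X *ₛ β₂)) ≈ 1ₛ *ₛ (β₂ +ₛ const 2ℚ *ₛ X) +ₛ (-ₛ X) *ₛ (-ₛ (D β₂ +ₛ const 2ℚ))
  reflect-D[X*ₛβ₂] = begin
    reflect (1ₛ *ₛ β₂ +ₛ X *ₛ D β₂)                       ≈⟨ scale-+ₛ (- 1ℚ) (1ₛ *ₛ β₂) (X *ₛ D β₂) ⟩
    reflect (1ₛ *ₛ β₂) +ₛ reflect (X *ₛ D β₂)             ≈⟨ +ₛ-cong (scale-*ₛ (- 1ℚ) 1ₛ β₂) (scale-*ₛ (- 1ℚ) X (D β₂)) ⟩
    reflect 1ₛ *ₛ reflect β₂ +ₛ reflect X *ₛ reflect (D β₂) ≈⟨ +ₛ-cong (*ₛ-cong (scale-const (- 1ℚ) 1ℚ) reflect-β₂) (*ₛ-cong reflect-X reflect-Dβ₂) ⟩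
    1ₛ *ₛ (β₂ +ₛ const 2ℚ *ₛ X) +ₛ (-ₛ X) *ₛ (-ₛ (D β₂ +ₛ const 2ℚ)) ∎
    where open ≈-Reasoning

  reflect-K : reflect K ≈ (-ₛ D α) *ₛ ((-ₛ X) *ₛ e⁻ˣ -ₛ e⁻ˣ)
                          -ₛ (1ₛ *ₛ (β₂ +ₛ const 2ℚ *ₛ X) +ₛ (-ₛ X) *ₛ (-ₛ (D β₂ +ₛ const 2ℚ)))
  reflect-K = begin
    reflect (D α *ₛ w -ₛ D (X *ₛ β₂))                   ≈⟨ scale-+ₛ (- 1ℚ) (D α *ₛ w) (-ₛ D (X *ₛ β₂)) ⟩
    reflect (D α *ₛ w) +ₛ reflect (-ₛ D (X *ₛ β₂))      ≈⟨ +ₛ-cong (scale-*ₛ (- 1ℚ) (D α) w) (scale-neg (- 1ℚ) (D (X *ₛ β₂))) ⟩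
    reflect (D α) *ₛ reflect w -ₛ reflect (D (X *ₛ β₂)) ≈⟨ +ₛ-cong (*ₛ-cong reflect-Dα reflect-w) (-ₛ-cong reflect-D[X*ₛβ₂]) ⟩
    (-ₛ D α) *ₛ ((-ₛ X) *ₛ e⁻ˣ -ₛ e⁻ˣ)
      -ₛ (1ₛ *ₛ (β₂ +ₛ const 2ℚ *ₛ X) +ₛ (-ₛ X) *ₛ (-ₛ (D β₂ +ₛ const 2ℚ)))   ∎
    where open ≈-Reasoning

  ½α*ₛ2sinh : const ½ *ₛ α *ₛ 2sinh ≈ X
  ½α*ₛ2sinh = begin
    const ½ *ₛ α *ₛ 2sinh          ≈⟨ solve 3 (λ h a s → h :* a :* s := h :* (a :* s)) ≈-refl (const ½) α 2sinh ⟩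
    const ½ *ₛ (α *ₛ 2sinh)        ≈⟨ *ₛ-congˡ (const ½) α*ₛ2sinh ⟩
    const ½ *ₛ (const 2ℚ *ₛ X)     ≈⟨ solve 1 (λ x → con ½ :* (con 2ℚ :* x) := x) ≈-refl X ⟩
    X                              ∎
    where open ≈-Reasoning

  -- times 2sinh² this is a ring identity given the four relations above; ½α*ₛ2sinh makes 2sinh cancellable
  K+reflect-K : K +ₛ reflect K ≈ const (- 2ℚ) *ₛ (1ₛ +ₛ X *ₛ X)
  K+reflect-K = *ₛ-cancelʳ-divisor-of-X ½α*ₛ2sinh (*ₛ-cancelʳ-divisor-of-X ½α*ₛ2sinh
    (≈-trans (*ₛ-congʳ 2sinh (*ₛ-congʳ 2sinh (+ₛ-congˡ K reflect-K)))
    (linear-combination (2sinh *ₛ (X *ₛ 2cosh -ₛ 2sinh)) D[α*ₛ2sinh]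
    (linear-combination (-ₛ (2cosh *ₛ (X *ₛ 2cosh -ₛ 2sinh))) α*ₛ2sinh
    (linear-combination (const 2ℚ *ₛ X *ₛ 2cosh -ₛ const 2ℚ *ₛ 2sinh) β₂*ₛ2sinh
    (linear-combination (-ₛ (const 2ℚ *ₛ X *ₛ 2sinh)) D[β₂*ₛ2sinh]
    (solve 7 (λ da a b₂ db x e ē →
       let s = e :- ē
           c = e :+ ē
       in (da :* (x :* e :- e) :- (con 1ℚ :* b₂ :+ x :* db)
           :+ ((:- da) :* ((:- x) :* ē :- ē) :- (con 1ℚ :* (b₂ :+ con 2ℚ :* x) :+ (:- x) :* (:- (db :+ con 2ℚ))))) :* s :* s
       := con (- 2ℚ) :* (con 1ℚ :+ x :* x) :* s :* s
          :+ s :* (x :* c :- s) :* (da :* s :+ a :* c :- con 2ℚ)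
          :+ (:- (c :* (x :* c :- s))) :* (a :* s :- con 2ℚ :* x)
          :+ (con 2ℚ :* x :* c :- con 2ℚ :* s) :* (b₂ :* s :- con 2ℚ :* x :* ē)
          :+ (:- (con 2ℚ :* x :* s)) :* (db :* s :+ b₂ :* c :- (con 2ℚ :* ē :- con 2ℚ :* x :* ē)))
      ≈-refl (D α) α β₂ (D β₂) X eˣ e⁻ˣ)))))))

  Dα*ₛw≡D[X*ₛβ₂]-even-coeff : ∀ j → 2 ≤ j → (D α *ₛ w) (2 ℕ.* j) ≡ D (X *ₛ β₂) (2 ℕ.* j)
  Dα*ₛw≡D[X*ₛβ₂]-even-coeff j 2≤j = x-y≡0⇒x≡y ((D α *ₛ w) N) (D (X *ₛ β₂) N) (x+x≡0⇒x≡0 (K N) (begin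
    K N + K N                               ≡⟨ cong (K N +_) (reflect-even-coeff K j) ⟨
    (K +ₛ reflect K) N                      ≡⟨ at K+reflect-K N ⟩
    (const (- 2ℚ) *ₛ (1ₛ +ₛ X *ₛ X)) N     ≡⟨ at (const-*ₛ (- 2ℚ) (1ₛ +ₛ X *ₛ X)) N ⟩
    - 2ℚ * (1ₛ +ₛ X *ₛ X) N                 ≡⟨ cong (- 2ℚ *_) (1+X²-high-coeff N 3≤N) ⟩
    - 2ℚ * 0ℚ                               ≡⟨ ℚP.*-zeroʳ (- 2ℚ) ⟩
    0ℚ                                      ∎))
    where
    open ≡-Reasoning
    N = 2 ℕ.* j
    3≤N : 3 ≤ N
    3≤N = ℕP.≤-trans (ℕP.n≤1+n 3) (ℕP.*-monoʳ-≤ 2 2≤j)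

  α-coeff : ∀ k → α k ≡ 2ℚ * β k - 2ℚ ^ℚ k * β k
  α-coeff k = cong (_- 2ℚ ^ℚ k * β k) (at (const-*ₛ 2ℚ β) k)

  w-coeff : ∀ t → w (suc t) ≡ ℕ→ℚ t
  w-coeff t = begin
    (X *ₛ eˣ) (suc t) - 1ℚ ^ℚ suc t     ≡⟨ cong₂ _-_ (X*ₛ-suc eˣ t) (1^n≡1 (suc t)) ⟩
    ℕ→ℚ (suc t) * 1ℚ ^ℚ t - 1ℚ          ≡⟨ cong₂ (λ m p → m * p - 1ℚ) (ℕ→ℚ-+ 1 t) (1^n≡1 t) ⟩
    (1ℚ + ℕ→ℚ t) * 1ℚ - 1ℚ              ≡⟨ simplify (ℕ→ℚ t) ⟩
    ℕ→ℚ t                               ∎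
    where
    open ≡-Reasoning
    simplify : ∀ t → (1ℚ + t) * 1ℚ - 1ℚ ≡ t
    simplify = solve-∀ ℚ-ring

-- The Bernoulli numbers

bernTable≡applyDownFrom : ∀ m → bernTable m ≡ applyDownFrom B (suc m)
bernTable≡applyDownFrom zero    = refl
bernTable≡applyDownFrom (suc m) = cong (B (suc m) ∷_) (bernTable≡applyDownFrom m)

zip-applyUpTo : ∀ {A B : Set} (f : ℕ → A) (g : ℕ → B) n → zip (applyUpTo f n) (applyUpTo g n) ≡ applyUpTo (λ k → f k , g k) n
zip-applyUpTo f g zero    = refl
zip-applyUpTo f g (suc n) = cong ((f 0 , g 0) ∷_) (zip-applyUpTo (f ∘ suc) (g ∘ suc) n)

B-recurrence : ∀ m → B (suc m) ≡ - ((ℤ.+ 1 / suc (suc m)) * ∑[ k < suc m ] (ℕ→ℚ (suc (suc m) C k) * B k))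
B-recurrence m = cong (λ t → - ((ℤ.+ 1 / suc (suc m)) * t)) (begin
  sumℚ (map term (zip (upTo (suc m)) (reverse (bernTable m))))
    ≡⟨ cong (λ l → sumℚ (map term (zip (upTo (suc m)) (reverse l)))) (bernTable≡applyDownFrom m) ⟩
  sumℚ (map term (zip (upTo (suc m)) (reverse (applyDownFrom B (suc m)))))
    ≡⟨ cong (λ l → sumℚ (map term (zip (upTo (suc m)) l))) (List.reverse-applyDownFrom B (suc m)) ⟩
  sumℚ (map term (zip (upTo (suc m)) (applyUpTo B (suc m))))
    ≡⟨ cong (sumℚ ∘ map term) (zip-applyUpTo (λ k → k) B (suc m)) ⟩
  sumℚ (map term (applyUpTo (λ k → k , B k) (suc m)))
    ≡⟨ cong sumℚ (List.map-applyUpTo (λ k → k , B k) term (suc m)) ⟩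
  sumℚ (applyUpTo (λ k → ℕ→ℚ (suc (suc m) C k) * B k) (suc m))
    ≡⟨ sumℚ-applyUpTo (λ k → ℕ→ℚ (suc (suc m) C k) * B k) (suc m) ⟩
  ∑[ k < suc m ] (ℕ→ℚ (suc (suc m) C k) * B k) ∎)
  where
  open ≡-Reasoning
  term : ℕ × ℚ → ℚ
  term (k , b) = ℕ→ℚ (suc (suc m) C k) * b

B*ₛeˣ-coeff : ∀ m → (B *ₛ eˣ) (suc (suc m)) ≡ B (suc (suc m))
B*ₛeˣ-coeff m = begin
  (B *ₛ eˣ) N                                     ≡⟨ *ₛ-binomial B eˣ N ⟩
  ∑[ k < suc N ] (ℕ→ℚ (N C k) * (B k * 1ℚ ^ℚ (N ∸ k)))
    ≡⟨ ∑-cong (suc N) (λ k _ → cong (λ t → ℕ→ℚ (N C k) * (B k * t)) (1^n≡1 (N ∸ k))) ⟩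
  ∑[ k < suc N ] (ℕ→ℚ (N C k) * (B k * 1ℚ))       ≡⟨ ∑-cong (suc N) (λ k _ → cong (ℕ→ℚ (N C k) *_) (ℚP.*-identityʳ (B k))) ⟩
  ∑ (suc N) term                                  ≡⟨ ∑-init-last N term ⟩
  ∑ N term + term N                               ≡⟨ cong (_+ term N) (∑-init-last (suc m) term) ⟩
  T + ℕ→ℚ (N C suc m) * B (suc m) + ℕ→ℚ (N C N) * B N
    ≡⟨ cong₂ (λ c d → T + ℕ→ℚ c * B (suc m) + ℕ→ℚ d * B N) N-choose-pred (nCn≡1 N) ⟩
  T + ℕ→ℚ N * B (suc m) + 1ℚ * B N                ≡⟨ cong (λ b → T + ℕ→ℚ N * b + 1ℚ * B N) (B-recurrence m) ⟩
  T + ℕ→ℚ N * - (1/N * T) + 1ℚ * B N              ≡⟨ reassoc T (ℕ→ℚ N) 1/N (B N) ⟩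
  T - 1/N * ℕ→ℚ N * T + 1ℚ * B N                  ≡⟨ cong (λ c → T - c * T + 1ℚ * B N) (1/[1+n]*[1+n]≡1 (suc m)) ⟩
  T - 1ℚ * T + 1ℚ * B N                           ≡⟨ cancel T (B N) ⟩
  B N                                             ∎
  where
  open ≡-Reasoning
  N   = suc (suc m)
  1/N = ℤ.+ 1 / N
  term : ℕ → ℚ
  term k = ℕ→ℚ (N C k) * B k
  T = ∑ (suc m) term
  N-choose-pred : N C suc m ≡ N
  N-choose-pred = trans (nCk≡nC[n∸k] (ℕP.n≤1+n (suc m))) (trans (cong (N C_) (ℕP.m+n∸n≡m 1 (suc m))) (nC1≡n N))
  reassoc : ∀ t n i b → t + n * - (i * t) + 1ℚ * b ≡ t - i * n * t + 1ℚ * b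
  reassoc = solve-∀ ℚ-ring
  cancel : ∀ t b → t - 1ℚ * t + 1ℚ * b ≡ b
  cancel = solve-∀ ℚ-ring

B-egf : B *ₛ (eˣ -ₛ 1ₛ) ≈ X
B-egf = pointwise coeff
  where
  coeff : ∀ k → (B *ₛ (eˣ -ₛ 1ₛ)) k ≡ X k
  coeff zero          = refl
  coeff (suc zero)    = refl
  coeff (suc (suc m)) = begin
    (B *ₛ (eˣ -ₛ 1ₛ)) N      ≡⟨ at (solve 2 (λ b e → b :* (e :- con 1ℚ) := b :* e :- b) ≈-refl B eˣ) N ⟩
    (B *ₛ eˣ) N - B N        ≡⟨ cong (_- B N) (B*ₛeˣ-coeff m) ⟩
    B N - B N                ≡⟨ ℚP.+-inverseʳ (B N) ⟩
    0ℚ                       ∎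
    where
    open ≡-Reasoning
    N = suc (suc m)

-- The coefficient of x⁴ⁿ⁺²

Σ[⋯]≡∑ : ∀ a b f → Σ[ a ⋯ b ] f ≡ ∑[ i < suc b ∸ a ] f (a ℕ.+ i)
Σ[⋯]≡∑ a b f = trans (cong sumℚ (List.map-upTo (λ i → f (a ℕ.+ i)) (suc b ∸ a))) (sumℚ-applyUpTo (λ i → f (a ℕ.+ i)) (suc b ∸ a))

2M∸[1+2j]≡1+2[M∸[1+j]] : ∀ {M j} → j < M → 2 ℕ.* M ∸ suc (2 ℕ.* j) ≡ suc (2 ℕ.* (M ∸ suc j))
2M∸[1+2j]≡1+2[M∸[1+j]] {M} {j} j<M = begin
  2 ℕ.* M ∸ suc (2 ℕ.* j)                             ≡⟨ cong (λ m → 2 ℕ.* m ∸ suc (2 ℕ.* j)) (ℕP.m∸n+n≡m j<M) ⟨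
  2 ℕ.* (r ℕ.+ suc j) ∸ suc (2 ℕ.* j)                 ≡⟨ cong (_∸ suc (2 ℕ.* j)) (split r j) ⟩
  suc (2 ℕ.* r) ℕ.+ suc (2 ℕ.* j) ∸ suc (2 ℕ.* j)     ≡⟨ ℕP.m+n∸n≡m (suc (2 ℕ.* r)) (suc (2 ℕ.* j)) ⟩
  suc (2 ℕ.* r)                                       ∎
  where
  open ≡-Reasoning
  r = M ∸ suc j
  split : ∀ r j → 2 ℕ.* (r ℕ.+ suc j) ≡ suc (2 ℕ.* r) ℕ.+ suc (2 ℕ.* j)
  split = ℕ-solve-∀

4n+2≡2[2n+1] : ∀ n → 4 ℕ.* n ℕ.+ 2 ≡ 2 ℕ.* (2 ℕ.* n ℕ.+ 1)
4n+2≡2[2n+1] = ℕ-solve-∀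

summand : ℕ → ℕ → ℚ
summand n j = ℕ→ℚ ((4 ℕ.* n ℕ.+ 2) C (2 ℕ.* j ∸ 1))
            * (ℕ→ℚ (2 ℕ.* n ℕ.+ 1) - ℕ→ℚ j)
            * (1ℚ - ℕ→ℚ (2 ^ (2 ℕ.* j ∸ 1)))
            * B (2 ℕ.* j)

summand-suc : ∀ n j → summand n (suc j) ≡ ℕ→ℚ ((4 ℕ.* n ℕ.+ 2) C suc (2 ℕ.* j))
                                         * (ℕ→ℚ (2 ℕ.* n ℕ.+ 1) - ℕ→ℚ (suc j))
                                         * (1ℚ - 2ℚ ^ℚ suc (2 ℕ.* j))
                                         * B (suc (suc (2 ℕ.* j)))
summand-suc n j = trans
  (cong₂ (λ i k → ℕ→ℚ ((4 ℕ.* n ℕ.+ 2) C i) * (ℕ→ℚ (2 ℕ.* n ℕ.+ 1) - ℕ→ℚ (suc j)) * (1ℚ - ℕ→ℚ (2 ^ i)) * B k)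
         (cong (_∸ 1) (ℕP.*-suc 2 j)) (ℕP.*-suc 2 j))
  (cong (λ p → ℕ→ℚ ((4 ℕ.* n ℕ.+ 2) C suc (2 ℕ.* j)) * (ℕ→ℚ (2 ℕ.* n ℕ.+ 1) - ℕ→ℚ (suc j)) * (1ℚ - p) * B (suc (suc (2 ℕ.* j))))
        (ℕ→ℚ-^ 2 (suc (2 ℕ.* j))))

open BernoulliSeries B B-egf

Dα*ₛw-coeff : ∀ n → (D α *ₛ w) (2 ℕ.* (2 ℕ.* n ℕ.+ 1)) ≡ 4ℚ * ∑[ j < 2 ℕ.* n ℕ.+ 1 ] summand n (suc j)
Dα*ₛw-coeff n = begin
  (D α *ₛ w) (2 ℕ.* M)                               ≡⟨ *ₛ-binomial (D α) w (2 ℕ.* M) ⟩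
  ∑ (suc (2 ℕ.* M)) term                             ≡⟨ ∑-init-last (2 ℕ.* M) term ⟩
  ∑ (2 ℕ.* M) term + term (2 ℕ.* M)                  ≡⟨ cong (∑ (2 ℕ.* M) term +_) (even-term M) ⟩
  ∑ (2 ℕ.* M) term + 0ℚ                              ≡⟨ ℚP.+-identityʳ (∑ (2 ℕ.* M) term) ⟩
  ∑ (2 ℕ.* M) term                                   ≡⟨ ∑-even-odd M term ⟩
  ∑[ j < M ] term (2 ℕ.* j) + ∑[ j < M ] term (suc (2 ℕ.* j))
    ≡⟨ cong (_+ ∑[ j < M ] term (suc (2 ℕ.* j))) (trans (∑-cong M (λ j _ → even-term j)) (∑-zero M)) ⟩
  0ℚ + ∑[ j < M ] term (suc (2 ℕ.* j))               ≡⟨ ℚP.+-identityˡ (∑[ j < M ] term (suc (2 ℕ.* j))) ⟩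
  ∑[ j < M ] term (suc (2 ℕ.* j))                    ≡⟨ ∑-cong M odd-term ⟩
  ∑[ j < M ] (4ℚ * summand n (suc j))                ≡⟨ *-distribˡ-∑ 4ℚ M (summand n ∘ suc) ⟨
  4ℚ * ∑[ j < M ] summand n (suc j)                  ∎
  where
  open ≡-Reasoning
  M = 2 ℕ.* n ℕ.+ 1
  N = 2 ℕ.* M
  term : ℕ → ℚ
  term k = ℕ→ℚ (N C k) * (α (suc k) * w (N ∸ k))
  even-term : ∀ j → term (2 ℕ.* j) ≡ 0ℚ
  even-term j = begin
    ℕ→ℚ (N C 2 ℕ.* j) * (α (suc (2 ℕ.* j)) * w (N ∸ 2 ℕ.* j))  ≡⟨ cong (λ a → ℕ→ℚ (N C 2 ℕ.* j) * (a * w (N ∸ 2 ℕ.* j))) (even-series-odd-coeff reflect-α j) ⟩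
    ℕ→ℚ (N C 2 ℕ.* j) * (0ℚ * w (N ∸ 2 ℕ.* j))                 ≡⟨ cong (ℕ→ℚ (N C 2 ℕ.* j) *_) (ℚP.*-zeroˡ (w (N ∸ 2 ℕ.* j))) ⟩
    ℕ→ℚ (N C 2 ℕ.* j) * 0ℚ                                      ≡⟨ ℚP.*-zeroʳ (ℕ→ℚ (N C 2 ℕ.* j)) ⟩
    0ℚ                                                          ∎
  odd-term : ∀ j → j < M → term (suc (2 ℕ.* j)) ≡ 4ℚ * summand n (suc j)
  odd-term j j<M = begin
    ℕ→ℚ (N C suc (2 ℕ.* j)) * (α (suc (suc (2 ℕ.* j))) * w (N ∸ suc (2 ℕ.* j)))
      ≡⟨ cong (λ m → ℕ→ℚ (m C suc (2 ℕ.* j)) * (α (suc (suc (2 ℕ.* j))) * w (N ∸ suc (2 ℕ.* j)))) (4n+2≡2[2n+1] n) ⟨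
    c * (α (suc (suc (2 ℕ.* j))) * w (N ∸ suc (2 ℕ.* j)))
      ≡⟨ cong₂ (λ a t → c * (a * t)) (α-coeff (suc (suc (2 ℕ.* j))))
               (trans (cong w (2M∸[1+2j]≡1+2[M∸[1+j]] j<M)) (trans (w-coeff (2 ℕ.* (M ∸ suc j))) (ℕ→ℚ-* 2 (M ∸ suc j)))) ⟩
    c * ((2ℚ * b - 2ℚ * P * b) * (2ℚ * ℕ→ℚ (M ∸ suc j)))
      ≡⟨ cong (λ a → c * ((2ℚ * b - 2ℚ * P * b) * (2ℚ * a))) (ℕ→ℚ-∸ j<M) ⟩
    c * ((2ℚ * b - 2ℚ * P * b) * (2ℚ * (ℕ→ℚ M - ℕ→ℚ (suc j))))
      ≡⟨ factor c b P (ℕ→ℚ M - ℕ→ℚ (suc j)) ⟩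
    4ℚ * (c * (ℕ→ℚ M - ℕ→ℚ (suc j)) * (1ℚ - P) * b)
      ≡⟨ cong (4ℚ *_) (summand-suc n j) ⟨
    4ℚ * summand n (suc j)
      ∎
    where
    c = ℕ→ℚ ((4 ℕ.* n ℕ.+ 2) C suc (2 ℕ.* j))
    b = B (suc (suc (2 ℕ.* j)))
    P = 2ℚ ^ℚ suc (2 ℕ.* j)
    factor : ∀ c b P a → c * ((2ℚ * b - 2ℚ * P * b) * (2ℚ * a)) ≡ 4ℚ * (c * a * (1ℚ - P) * b)
    factor = solve-∀ ℚ-ring

D[X*ₛβ₂]-coeff : ∀ n → D (X *ₛ β₂) (4 ℕ.* n ℕ.+ 2) ≡ 4ℚ * (ℕ→ℚ (4 ℕ.* n ℕ.+ 3) * ℕ→ℚ (2 ^ (4 ℕ.* n)) * B (4 ℕ.* n ℕ.+ 2))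
D[X*ₛβ₂]-coeff n = begin
  D (X *ₛ β₂) N                                      ≡⟨ X*ₛ-suc β₂ N ⟩
  ℕ→ℚ (suc N) * (2ℚ ^ℚ N * B N)                     ≡⟨ cong₂ (λ m p → ℕ→ℚ m * (p * B N)) (ℕP.+-suc (4 ℕ.* n) 2) (sym (^-homo-* 2ℚ (4 ℕ.* n) 2)) ⟨
  ℕ→ℚ (4 ℕ.* n ℕ.+ 3) * (2ℚ ^ℚ (4 ℕ.* n) * 4ℚ * B N) ≡⟨ cong (λ p → ℕ→ℚ (4 ℕ.* n ℕ.+ 3) * (p * 4ℚ * B N)) (ℕ→ℚ-^ 2 (4 ℕ.* n)) ⟨
  ℕ→ℚ (4 ℕ.* n ℕ.+ 3) * (ℕ→ℚ (2 ^ (4 ℕ.* n)) * 4ℚ * B N) ≡⟨ pull-out (ℕ→ℚ (4 ℕ.* n ℕ.+ 3)) (ℕ→ℚ (2 ^ (4 ℕ.* n))) (B N) ⟩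
  4ℚ * (ℕ→ℚ (4 ℕ.* n ℕ.+ 3) * ℕ→ℚ (2 ^ (4 ℕ.* n)) * B N) ∎
  where
  open ≡-Reasoning
  N = 4 ℕ.* n ℕ.+ 2
  pull-out : ∀ a p b → a * (p * 4ℚ * b) ≡ 4ℚ * (a * p * b)
  pull-out = solve-∀ ℚ-ring

corollary2 : (n : ℕ) → n ≥ 1 →
  Σ[ 1 ⋯ 2 ℕ.* n ℕ.+ 1 ] (λ j →
      ℕ→ℚ ((4 ℕ.* n ℕ.+ 2) C (2 ℕ.* j ∸ 1))
    * (ℕ→ℚ (2 ℕ.* n ℕ.+ 1) - ℕ→ℚ j)
    * (1ℚ - ℕ→ℚ (2 ^ (2 ℕ.* j ∸ 1)))
    * B (2 ℕ.* j))
  ≡ ℕ→ℚ (4 ℕ.* n ℕ.+ 3) * ℕ→ℚ (2 ^ (4 ℕ.* n)) * B (4 ℕ.* n ℕ.+ 2)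
corollary2 n n≥1 = invertible-*-cancelˡ 4ℚ (ℤ.+ 1 / 4) refl (begin
  4ℚ * Σ[ 1 ⋯ M ] (summand n)               ≡⟨ cong (4ℚ *_) (Σ[⋯]≡∑ 1 M (summand n)) ⟩
  4ℚ * ∑[ j < M ] summand n (suc j)         ≡⟨ Dα*ₛw-coeff n ⟨
  (D α *ₛ w) (2 ℕ.* M)                      ≡⟨ Dα*ₛw≡D[X*ₛβ₂]-even-coeff M 2≤M ⟩
  D (X *ₛ β₂) (2 ℕ.* M)                     ≡⟨ cong (D (X *ₛ β₂)) (4n+2≡2[2n+1] n) ⟨
  D (X *ₛ β₂) (4 ℕ.* n ℕ.+ 2)               ≡⟨ D[X*ₛβ₂]-coeff n ⟩
  4ℚ * (ℕ→ℚ (4 ℕ.* n ℕ.+ 3) * ℕ→ℚ (2 ^ (4 ℕ.* n)) * B (4 ℕ.* n ℕ.+ 2)) ∎)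
  where
  open ≡-Reasoning
  M = 2 ℕ.* n ℕ.+ 1
  2≤M : 2 ≤ M
  2≤M = ℕP.≤-trans (ℕP.n≤1+n 2) (ℕP.+-monoˡ-≤ 1 (ℕP.*-monoʳ-≤ 2 n≥1))
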